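{- Let $m\ge 2$ be an integer, let $p=\lceil 6\log m\rceil$, let $A$ be a set with $|A|=d\ge 100\sqrt{m}\,\log^{1.5} m$, and let $C$ be a finite set disjoint from $A$. Let $\sigma_C$ be a uniformly random ordering of $A\cup C$, with $\sigma_C(x)$ the position of $x$, and let $A'(\sigma_C)$ be the set of the first $p$ elements of $A$ in the order $\sigma_C$. Then $$\Pr_{\sigma_C}\Big[\min_{v\in C}\sigma_C(v)<\max_{u\in A'(\sigma_C)}\sigma_C(u)\Big]\le \frac{2p|C|}{d}.$$
   Context: A minimum over the empty set is $+\infty$. -}

module Defs where

open import Data.Nat as ℕ using (ℕ; zero; suc; _<ᵇ_)
open import Data.Integer using (+_)
open import Data.Rational as ℚ using (ℚ; _/_; _+_; _*_; _-_)
open import Data.Bool using (Bool; true; false)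
open import Data.Fin using (Fin)
open import Data.Sum using (_⊎_; inj₁; inj₂)
open import Data.Maybe using (Maybe; just; nothing)
open import Data.List using (List; []; _∷_; map; concatMap; _++_; take; mapMaybe; filter; length)
open import Data.Bool.ListAction using (any)
open import Data.List using (allFin) public
open import Data.Product using (∃)
open import Relation.Binary.PropositionalEquality using (_≡_)

-- Natural logarithm, via the series  ln m = 2 Σ_k z^(2k+1)/(2k+1),
-- z = (m-1)/(m+1).  For m ≥ 1 all terms are ≥ 0, so the partial sums
-- lnApprox m N increase to ln m.

ℚ-pow : ℚ → ℕ → ℚ
ℚ-pow q zero    = ℚ.1ℚ
ℚ-pow q (suc n) = q * ℚ-pow q n

fromℕ : ℕ → ℚ
fromℕ n = (+ n) / 1

lnZ : ℕ → ℚ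
lnZ m = (+ (m ℕ.∸ 1)) / suc m

lnApprox : ℕ → ℕ → ℚ
lnApprox m zero    = ℚ.0ℚ
lnApprox m (suc N) =
  lnApprox m N + fromℕ 2 * ℚ-pow (lnZ m) (suc (2 ℕ.* N)) * ((+ 1) / suc (2 ℕ.* N))

-- p = ⌈ 6 ln m ⌉ , i.e.  p - 1 < 6 ln m ≤ p
-- (6 ln m ≤ p  iff every partial sum satisfies it; p - 1 < 6 ln m iff some does)
IsCeil6Ln : ℕ → ℕ → Set
IsCeil6Ln m p =
  (∃ λ N → fromℕ p - ℚ.1ℚ ℚ.< fromℕ 6 * lnApprox m N)
  × (∀ N → fromℕ 6 * lnApprox m N ℚ.≤ fromℕ p)
  where open import Data.Product using (_×_)

-- d ≥ 100 √m (ln m)^1.5 , equivalently (both sides ≥ 0)  d² ≥ 10⁴ m (ln m)³,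
-- i.e. every partial sum L satisfies 10⁴ m L³ ≤ d².
BigEnough : ℕ → ℕ → Set
BigEnough m d = ∀ N → fromℕ (10000 ℕ.* m) * ℚ-pow (lnApprox m N) 3 ℚ.≤ fromℕ (d ℕ.* d)

-- Orderings of a finite list of distinct elements, as lists.
-- perms xs lists every ordering of xs exactly once (when xs has no
-- duplicates), so counting in perms xs = uniform probability.

insertAll : {X : Set} → X → List X → List (List X)
insertAll x []       = (x ∷ []) ∷ []
insertAll x (y ∷ ys) = (x ∷ y ∷ ys) ∷ map (y ∷_) (insertAll x ys)

perms : {X : Set} → List X → List (List X)
perms []       = [] ∷ []
perms (x ∷ xs) = concatMap (insertAll x) (perms xs)

-- Setting: A = Fin d (|A| = d), C = Fin c (|C| = c), disjoint union A ⊎ C.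

Elt : ℕ → ℕ → Set
Elt d c = Fin d ⊎ Fin c

allElts : (d c : ℕ) → List (Elt d c)
allElts d c = map inj₁ (allFin d) ++ map inj₂ (allFin c)

eqElt : {d c : ℕ} → Elt d c → Elt d c → Bool
eqElt (inj₁ x) (inj₁ y) = Data.Nat._≡ᵇ_ (Data.Fin.toℕ x) (Data.Fin.toℕ y)
  where import Data.Nat; import Data.Fin
eqElt (inj₂ x) (inj₂ y) = Data.Nat._≡ᵇ_ (Data.Fin.toℕ x) (Data.Fin.toℕ y)
  where import Data.Nat; import Data.Fin
eqElt _ _ = false

-- σ(x): position (0-based) of x in the ordering
pos : {d c : ℕ} → List (Elt d c) → Elt d c → ℕ
pos []       x = 0
pos (y ∷ ys) x with eqElt y x
... | true  = 0
... | false = suc (pos ys x)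

isA : {d c : ℕ} → Elt d c → Maybe (Fin d)
isA (inj₁ a) = just a
isA (inj₂ _) = nothing

firstA : {d c : ℕ} → ℕ → List (Elt d c) → List (Fin d)
firstA p σ = take p (mapMaybe isA σ)

-- The event  min_{v ∈ C} σ(v) < max_{u ∈ A'(σ)} σ(u)
-- (min over ∅ = +∞, max over ∅ = -∞; for finite sets this is
--  "some v ∈ C precedes some u ∈ A'(σ)").
badEvent : (d c p : ℕ) → List (Elt d c) → Bool
badEvent d c p σ =
  any (λ v → any (λ u → pos σ (inj₂ v) <ᵇ pos σ (inj₁ u)) (firstA p σ)) (allFin c)

badCount : (d c p : ℕ) → ℕ
badCount d c p = length (filter (λ σ → Data.Bool.T? (badEvent d c p σ)) (perms (allElts d c)))
  where import Data.Bool

totalCount : (d c : ℕ) → ℕ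
totalCount d c = length (perms (allElts d c))

module Submission where

-- Let r(σ) be the length of the initial run of elements of A in an ordering σ of
-- A ∪ C, and n = |A ∪ C|.  If r(σ) ≥ p, the first p elements of A precede all of C,
-- so Pr[bad] ≤ Pr[r < p].  For C nonempty we show Pr[r = k] ≤ |C|/n for every k,
-- whence Pr[r < p] ≤ p|C|/n ≤ p|C|/d, stronger than the claimed 2p|C|/d; for C empty the bad event is impossible.
-- Pr[r = k] ≤ |C|/n is proved by induction on |A| following `perms`: inserting a new
-- a ∈ A into the n + 1 gaps of σ gives run length r(σ) + 1 in r(σ) + 1 gaps and r(σ)
-- in the other n - r(σ) gaps, so #{r = k} becomes k·#{r = k-1} + (n-k)·#{r = k},
-- a convex combination of counts both at most |C|·#S/n (invariant `RunBound`).
-- Probabilities are counts `sumOf f S` = Σ_{σ ∈ S} f σ.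

open import Defs
open import Data.Nat using (ℕ; _≤_; _*_; zero; suc; _+_; _∸_; _<_; _≡ᵇ_; _<ᵇ_; z≤n; s≤s; _≤?_)
open import Data.Nat.Properties
open import Data.Bool using (Bool; true; false; T; T?)
open import Data.Fin using (Fin; toℕ)
open import Data.Sum using (_⊎_; inj₁; inj₂)
open import Data.Product using (∃-syntax; _,_)
open import Data.List using (List; []; _∷_; map; concatMap; _++_; filter; length)
open import Data.List.Properties using (length-map; length-tabulate)
open import Data.List.Relation.Unary.All as All using (All; []; _∷_)
open import Data.List.Relation.Unary.All.Properties using (map⁺; concat⁺)
open import Data.Bool.ListAction using (any)
open import Function using (_∘_)
open import Relation.Nullary using (yes; no)
open import Relation.Binary.PropositionalEquality
open import Algebra.Properties.CommutativeSemigroup +-commutativeSemigroup using (interchange)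

private
  variable
    X Y : Set

𝟙 : Bool → ℕ
𝟙 true  = 1
𝟙 false = 0

𝟙≤1 : ∀ b → 𝟙 b ≤ 1
𝟙≤1 true  = s≤s z≤n
𝟙≤1 false = z≤n

sumOf : (X → ℕ) → List X → ℕ
sumOf f []       = 0
sumOf f (x ∷ xs) = f x + sumOf f xs

sumOf-const : (m : ℕ) (xs : List X) → sumOf (λ _ → m) xs ≡ length xs * m
sumOf-const m []       = refl
sumOf-const m (x ∷ xs) = cong (m +_) (sumOf-const m xs)

sumOf-one : (xs : List X) → sumOf (λ _ → 1) xs ≡ length xs
sumOf-one xs = trans (sumOf-const 1 xs) (*-identityʳ (length xs))

sumOf-zero : (xs : List X) → sumOf (λ _ → 0) xs ≡ 0
sumOf-zero xs = trans (sumOf-const 0 xs) (*-zeroʳ (length xs))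

sumOf-map : (f : Y → ℕ) (h : X → Y) (xs : List X) → sumOf f (map h xs) ≡ sumOf (f ∘ h) xs
sumOf-map f h []       = refl
sumOf-map f h (x ∷ xs) = cong (f (h x) +_) (sumOf-map f h xs)

sumOf-++ : (f : X → ℕ) (xs ys : List X) → sumOf f (xs ++ ys) ≡ sumOf f xs + sumOf f ys
sumOf-++ f []       ys = refl
sumOf-++ f (x ∷ xs) ys = trans (cong (f x +_) (sumOf-++ f xs ys)) (sym (+-assoc (f x) _ _))

sumOf-concatMap : (f : Y → ℕ) (g : X → List Y) (xs : List X) →
  sumOf f (concatMap g xs) ≡ sumOf (sumOf f ∘ g) xs
sumOf-concatMap f g []       = refl
sumOf-concatMap f g (x ∷ xs) =
  trans (sumOf-++ f (g x) (concatMap g xs)) (cong (sumOf f (g x) +_) (sumOf-concatMap f g xs))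

sumOf-congᴬ : {f g : X → ℕ} (xs : List X) → All (λ x → f x ≡ g x) xs → sumOf f xs ≡ sumOf g xs
sumOf-congᴬ []       []         = refl
sumOf-congᴬ (x ∷ xs) (fx≡gx ∷ h) = cong₂ _+_ fx≡gx (sumOf-congᴬ xs h)

sumOf-mono : {f g : X → ℕ} (xs : List X) → (∀ x → f x ≤ g x) → sumOf f xs ≤ sumOf g xs
sumOf-mono []       f≤g = z≤n
sumOf-mono (x ∷ xs) f≤g = +-mono-≤ (f≤g x) (sumOf-mono xs f≤g)

sumOf-+ : (f g : X → ℕ) (xs : List X) → sumOf (λ x → f x + g x) xs ≡ sumOf f xs + sumOf g xs
sumOf-+ f g []       = refl
sumOf-+ f g (x ∷ xs) =
  trans (cong (f x + g x +_) (sumOf-+ f g xs)) (interchange (f x) (g x) (sumOf f xs) (sumOf g xs))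

sumOf-*ʳ : (f : X → ℕ) (m : ℕ) (xs : List X) → sumOf (λ x → f x * m) xs ≡ sumOf f xs * m
sumOf-*ʳ f m []       = refl
sumOf-*ʳ f m (x ∷ xs) = trans (cong (f x * m +_) (sumOf-*ʳ f m xs)) (sym (*-distribʳ-+ m (f x) _))

count≤length : (b : X → Bool) (xs : List X) → sumOf (𝟙 ∘ b) xs ≤ length xs
count≤length b xs = begin
  sumOf (𝟙 ∘ b) xs     ≤⟨ sumOf-mono xs (𝟙≤1 ∘ b) ⟩
  sumOf (λ _ → 1) xs   ≡⟨ sumOf-one xs ⟩
  length xs            ∎
  where open ≤-Reasoning

length-filter : (b : X → Bool) (xs : List X) → length (filter (T? ∘ b) xs) ≡ sumOf (𝟙 ∘ b) xs
length-filter b []       = refl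
length-filter b (x ∷ xs) with b x
... | true  = cong suc (length-filter b xs)
... | false = length-filter b xs

𝟙≡ᵇ-transfer : (f : ℕ → ℕ) (x y : ℕ) → 𝟙 (x ≡ᵇ y) * f x ≡ 𝟙 (x ≡ᵇ y) * f y
𝟙≡ᵇ-transfer f zero    zero    = refl
𝟙≡ᵇ-transfer f zero    (suc y) = refl
𝟙≡ᵇ-transfer f (suc x) zero    = refl
𝟙≡ᵇ-transfer f (suc x) (suc y) = 𝟙≡ᵇ-transfer (f ∘ suc) x y

𝟙≡ᵇ-< : ∀ {x y} → x < y → 𝟙 (x ≡ᵇ y) ≡ 0
𝟙≡ᵇ-< {zero}  {suc y} _         = refl
𝟙≡ᵇ-< {suc x} {suc y} (s≤s x<y) = 𝟙≡ᵇ-< x<y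

𝟙<ᵇ-suc : ∀ x p → 𝟙 (x <ᵇ suc p) ≡ 𝟙 (x <ᵇ p) + 𝟙 (x ≡ᵇ p)
𝟙<ᵇ-suc zero    zero    = refl
𝟙<ᵇ-suc zero    (suc p) = refl
𝟙<ᵇ-suc (suc x) zero    = refl
𝟙<ᵇ-suc (suc x) (suc p) = 𝟙<ᵇ-suc x p

count<-bound : (f : X → ℕ) (xs : List X) {n C : ℕ} →
  (∀ k → sumOf (λ x → 𝟙 (f x ≡ᵇ k)) xs * n ≤ C) →
  ∀ p → sumOf (λ x → 𝟙 (f x <ᵇ p)) xs * n ≤ p * C
count<-bound f xs {n} {C} count≡ zero rewrite sumOf-zero xs = z≤n
count<-bound f xs {n} {C} count≡ (suc p) = begin
  sumOf (λ x → 𝟙 (f x <ᵇ suc p)) xs * n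
    ≡⟨ cong (_* n) (sumOf-congᴬ xs (All.universal (λ x → 𝟙<ᵇ-suc (f x) p) xs)) ⟩
  sumOf (λ x → 𝟙 (f x <ᵇ p) + 𝟙 (f x ≡ᵇ p)) xs * n
    ≡⟨ cong (_* n) (sumOf-+ _ _ xs) ⟩
  (sumOf (λ x → 𝟙 (f x <ᵇ p)) xs + sumOf (λ x → 𝟙 (f x ≡ᵇ p)) xs) * n
    ≡⟨ *-distribʳ-+ n (sumOf (λ x → 𝟙 (f x <ᵇ p)) xs) _ ⟩
  sumOf (λ x → 𝟙 (f x <ᵇ p)) xs * n + sumOf (λ x → 𝟙 (f x ≡ᵇ p)) xs * n
    ≤⟨ +-mono-≤ (count<-bound f xs count≡ p) (count≡ p) ⟩
  p * C + C
    ≡⟨ +-comm (p * C) C ⟩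
  suc p * C ∎
  where open ≤-Reasoning

convex-bound : ∀ a b K M {n C} → a * n ≤ C → b * n ≤ C → K + M ≡ n → a * K + b * M ≤ C
convex-bound a b K M {zero} {C} _ _ K+M≡0
  rewrite m+n≡0⇒m≡0 K K+M≡0 | m+n≡0⇒n≡0 K K+M≡0 | *-zeroʳ a | *-zeroʳ b = z≤n
convex-bound a b K M {n@(suc _)} {C} an≤C bn≤C K+M≡n = *-cancelʳ-≤ _ _ n (begin
  (a * K + b * M) * n       ≡⟨ *-distribʳ-+ n (a * K) (b * M) ⟩
  a * K * n + b * M * n     ≡⟨ cong₂ _+_ (swap a K) (swap b M) ⟩
  a * n * K + b * n * M     ≤⟨ +-mono-≤ (*-monoˡ-≤ K an≤C) (*-monoˡ-≤ M bn≤C) ⟩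
  C * K + C * M             ≡⟨ sym (*-distribˡ-+ C K M) ⟩
  C * (K + M)               ≡⟨ cong (C *_) K+M≡n ⟩
  C * n                     ∎)
  where
  open ≤-Reasoning
  swap : ∀ x y → x * y * n ≡ x * n * y
  swap x y = trans (*-assoc x y n) (trans (cong (x *_) (*-comm y n)) (sym (*-assoc x n y)))

any-false : (f : X → Bool) (xs : List X) → All (λ x → f x ≡ false) xs → any f xs ≡ false
any-false f []       []          = refl
any-false f (x ∷ xs) (fx≡false ∷ h) rewrite fx≡false = any-false f xs h

All-concatMap : {P : X → Set} {Q : Y → Set} {g : X → List Y} {xs : List X} →
  (∀ {x} → P x → All Q (g x)) → All P xs → All Q (concatMap g xs)
All-concatMap h ps = concat⁺ (map⁺ (All.map h ps))

length-insertAll : (x : X) (ys : List X) → length (insertAll x ys) ≡ suc (length ys)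
length-insertAll x []       = refl
length-insertAll x (y ∷ ys) =
  cong suc (trans (length-map (y ∷_) (insertAll x ys)) (length-insertAll x ys))

insertAll-lengths : (x : X) (ys : List X) → All (λ τ → length τ ≡ suc (length ys)) (insertAll x ys)
insertAll-lengths x []       = refl ∷ []
insertAll-lengths x (y ∷ ys) = refl ∷ map⁺ (All.map (cong suc) (insertAll-lengths x ys))

insertAll-All : (P : X → Set) {x : X} {ys : List X} → P x → All P ys → All (All P) (insertAll x ys)
insertAll-All P px []         = (px ∷ []) ∷ []
insertAll-All P px (py ∷ pys) = (px ∷ py ∷ pys) ∷ map⁺ (All.map (py ∷_) (insertAll-All P px pys))

perms-All : (P : X → Set) {xs : List X} → All P xs → All (All P) (perms xs)
perms-All P []         = [] ∷ []
perms-All P (px ∷ pxs) = All-concatMap (insertAll-All P px) (perms-All P pxs)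

perms-lengths : (xs : List X) → All (λ σ → length σ ≡ length xs) (perms xs)
perms-lengths []       = refl ∷ []
perms-lengths (x ∷ xs) =
  All-concatMap (λ {σ} eq → All.map (λ e → trans e (cong suc eq)) (insertAll-lengths x σ))
                (perms-lengths xs)

module _ {A B : Set} where

  leadingA : List (A ⊎ B) → ℕ
  leadingA []           = 0
  leadingA (inj₁ _ ∷ σ) = suc (leadingA σ)
  leadingA (inj₂ _ ∷ σ) = 0

  leadingA-allB : {σ : List (A ⊎ B)} → All (λ x → ∃[ b ] x ≡ inj₂ b) σ → leadingA σ ≡ 0
  leadingA-allB []                = refl
  leadingA-allB ((b , refl) ∷ _) = refl

  -- Inserting a ∈ A into σ (r = leadingA σ, n = length σ): the r + 1 gaps inside or
  -- right after the initial run give run length r + 1, the remaining n - r gaps give r.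
  insertA-leadingA : (a : A) (g : ℕ → ℕ) (σ : List (A ⊎ B)) →
    sumOf (g ∘ leadingA) (insertAll (inj₁ a) σ)
      ≡ g (suc (leadingA σ)) * suc (leadingA σ) + g (leadingA σ) * (length σ ∸ leadingA σ)
  insertA-leadingA a g [] = cong₂ _+_ (sym (*-identityʳ (g 1))) (sym (*-zeroʳ (g 0)))
  insertA-leadingA a g (inj₂ b ∷ σ) = begin
    g 1 + sumOf (g ∘ leadingA) (map (inj₂ b ∷_) (insertAll (inj₁ a) σ))
      ≡⟨ cong (g 1 +_) (sumOf-map (g ∘ leadingA) (inj₂ b ∷_) (insertAll (inj₁ a) σ)) ⟩
    g 1 + sumOf (λ _ → g 0) (insertAll (inj₁ a) σ)
      ≡⟨ cong (g 1 +_) (sumOf-const (g 0) (insertAll (inj₁ a) σ)) ⟩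
    g 1 + length (insertAll (inj₁ a) σ) * g 0
      ≡⟨ cong₂ (λ x l → x + l * g 0) (sym (*-identityʳ (g 1))) (length-insertAll (inj₁ a) σ) ⟩
    g 1 * 1 + suc (length σ) * g 0
      ≡⟨ cong (g 1 * 1 +_) (*-comm (suc (length σ)) (g 0)) ⟩
    g 1 * 1 + g 0 * suc (length σ) ∎
    where open ≡-Reasoning
  insertA-leadingA a g (inj₁ b ∷ σ) = begin
    g (2 + r) + sumOf (g ∘ leadingA) (map (inj₁ b ∷_) (insertAll (inj₁ a) σ))
      ≡⟨ cong (g (2 + r) +_) (sumOf-map (g ∘ leadingA) (inj₁ b ∷_) (insertAll (inj₁ a) σ)) ⟩
    g (2 + r) + sumOf (g ∘ suc ∘ leadingA) (insertAll (inj₁ a) σ)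
      ≡⟨ cong (g (2 + r) +_) (insertA-leadingA a (g ∘ suc) σ) ⟩
    g (2 + r) + (g (2 + r) * suc r + g (suc r) * (length σ ∸ r))
      ≡⟨ sym (+-assoc (g (2 + r)) _ _) ⟩
    g (2 + r) + g (2 + r) * suc r + g (suc r) * (length σ ∸ r)
      ≡⟨ cong (_+ g (suc r) * (length σ ∸ r)) (sym (*-suc (g (2 + r)) (suc r))) ⟩
    g (2 + r) * (2 + r) + g (suc r) * (length σ ∸ r) ∎
    where
    open ≡-Reasoning
    r = leadingA σ

  runCount : ℕ → List (List (A ⊎ B)) → ℕ
  runCount k S = sumOf (λ σ → 𝟙 (leadingA σ ≡ᵇ k)) S

  shiftedRunCount : ℕ → List (List (A ⊎ B)) → ℕ
  shiftedRunCount k S = sumOf (λ σ → 𝟙 (suc (leadingA σ) ≡ᵇ k)) S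

  runCount-beyond : {n k : ℕ} (S : List (List (A ⊎ B))) →
    All (λ σ → leadingA σ < n) S → n ≤ k → runCount k S ≡ 0
  runCount-beyond {n} {k} S runs< n≤k = trans
    (sumOf-congᴬ S (All.map (λ r<n → 𝟙≡ᵇ-< (<-≤-trans r<n n≤k)) runs<))
    (sumOf-zero S)

  runCount-insert : (a : A) (k n : ℕ) (S : List (List (A ⊎ B))) → All (λ σ → length σ ≡ n) S →
    runCount k (concatMap (insertAll (inj₁ a)) S) ≡ shiftedRunCount k S * k + runCount k S * (n ∸ k)
  runCount-insert a k n S lengths = begin
    runCount k (concatMap (insertAll (inj₁ a)) S)
      ≡⟨ sumOf-concatMap _ (insertAll (inj₁ a)) S ⟩
    sumOf (λ σ → sumOf (λ τ → 𝟙 (leadingA τ ≡ᵇ k)) (insertAll (inj₁ a) σ)) S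
      ≡⟨ sumOf-congᴬ S (All.map (λ {σ} → perOrdering σ) lengths) ⟩
    sumOf (λ σ → 𝟙 (suc (leadingA σ) ≡ᵇ k) * k + 𝟙 (leadingA σ ≡ᵇ k) * (n ∸ k)) S
      ≡⟨ sumOf-+ _ _ S ⟩
    sumOf (λ σ → 𝟙 (suc (leadingA σ) ≡ᵇ k) * k) S + sumOf (λ σ → 𝟙 (leadingA σ ≡ᵇ k) * (n ∸ k)) S
      ≡⟨ cong₂ _+_ (sumOf-*ʳ _ k S) (sumOf-*ʳ _ (n ∸ k) S) ⟩
    shiftedRunCount k S * k + runCount k S * (n ∸ k) ∎
    where
    open ≡-Reasoning
    perOrdering : (σ : List (A ⊎ B)) → length σ ≡ n →
      sumOf (λ τ → 𝟙 (leadingA τ ≡ᵇ k)) (insertAll (inj₁ a) σ)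
        ≡ 𝟙 (suc (leadingA σ) ≡ᵇ k) * k + 𝟙 (leadingA σ ≡ᵇ k) * (n ∸ k)
    perOrdering σ refl = trans (insertA-leadingA a (λ r → 𝟙 (r ≡ᵇ k)) σ)
      (cong₂ _+_ (𝟙≡ᵇ-transfer (λ x → x) (suc (leadingA σ)) k)
                 (𝟙≡ᵇ-transfer (length σ ∸_) (leadingA σ) k))

  record RunBound (c n : ℕ) (S : List (List (A ⊎ B))) : Set where
    field
      lengths : All (λ σ → length σ ≡ n) S
      runs<   : All (λ σ → leadingA σ < n) S
      bound   : ∀ k → runCount k S * n ≤ c * length S

  runBound-insert : {c n : ℕ} {S : List (List (A ⊎ B))} (a : A) →
    RunBound c n S → RunBound c (suc n) (concatMap (insertAll (inj₁ a)) S)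
  runBound-insert {c} {n} {S} a rb = record
    { lengths = All-concatMap (λ {σ} eq → All.map (λ e → trans e (cong suc eq))
                                                  (insertAll-lengths (inj₁ a) σ)) lengths
    ; runs<   = All-concatMap (λ {σ} r<n → All.map (λ r′≤ → ≤-<-trans r′≤ (s≤s r<n))
                                                  (insertA-runs σ)) runs<
    ; bound   = bound′
    }
    where
    open RunBound rb
    S′ = concatMap (insertAll (inj₁ a)) S

    insertA-runs : (σ : List (A ⊎ B)) →
      All (λ τ → leadingA τ ≤ suc (leadingA σ)) (insertAll (inj₁ a) σ)
    insertA-runs []           = ≤-refl ∷ []
    insertA-runs (inj₂ b ∷ σ) = ≤-refl ∷ map⁺ (All.universal (λ _ → z≤n) (insertAll (inj₁ a) σ))
    insertA-runs (inj₁ b ∷ σ) = ≤-refl ∷ map⁺ (All.map s≤s (insertA-runs σ))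

    length-S′ : length S′ ≡ length S * suc n
    length-S′ = begin
      length S′                                  ≡⟨ sym (sumOf-one S′) ⟩
      sumOf (λ _ → 1) S′                         ≡⟨ sumOf-concatMap _ (insertAll (inj₁ a)) S ⟩
      sumOf (sumOf (λ _ → 1) ∘ insertAll (inj₁ a)) S
        ≡⟨ sumOf-congᴬ S (All.map (λ {σ} eq → trans (sumOf-one (insertAll (inj₁ a) σ))
                                         (trans (length-insertAll (inj₁ a) σ) (cong suc eq))) lengths) ⟩
      sumOf (λ _ → suc n) S                      ≡⟨ sumOf-const (suc n) S ⟩
      length S * suc n                           ∎
      where open ≡-Reasoning

    shifted : ∀ k → shiftedRunCount k S * n ≤ c * length S
    shifted zero    rewrite sumOf-zero S = z≤n
    shifted (suc k) = bound k

    beyond : ∀ k → n < k → shiftedRunCount k S * k + runCount k S * (n ∸ k) ≡ 0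
    beyond (suc k) (s≤s n≤k) = trans
      (cong₂ (λ x y → x * suc k + runCount (suc k) S * y)
             (runCount-beyond S runs< n≤k) (m≤n⇒m∸n≡0 (m≤n⇒m≤1+n n≤k)))
      (*-zeroʳ (runCount (suc k) S))

    recurrence-bound : ∀ k → shiftedRunCount k S * k + runCount k S * (n ∸ k) ≤ c * length S
    recurrence-bound k with k ≤? n
    ... | yes k≤n = convex-bound (shiftedRunCount k S) (runCount k S) k (n ∸ k) (shifted k) (bound k) (m+[n∸m]≡n k≤n)
    ... | no  k≰n = ≤-trans (≤-reflexive (beyond k (≰⇒> k≰n))) z≤n

    bound′ : ∀ k → runCount k S′ * suc n ≤ c * length S′
    bound′ k = begin
      runCount k S′ * suc n
        ≡⟨ cong (_* suc n) (runCount-insert a k n S lengths) ⟩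
      (shiftedRunCount k S * k + runCount k S * (n ∸ k)) * suc n
        ≤⟨ *-monoˡ-≤ (suc n) (recurrence-bound k) ⟩
      c * length S * suc n  ≡⟨ *-assoc c (length S) (suc n) ⟩
      c * (length S * suc n) ≡⟨ cong (c *_) (sym length-S′) ⟩
      c * length S′ ∎
      where open ≤-Reasoning

  runBound-onlyB : (bs : List B) → 0 < length bs →
    RunBound (length bs) (length bs) (perms (map inj₂ bs))
  runBound-onlyB bs nonempty = record
    { lengths = All.map (λ e → trans e (length-map inj₂ bs)) (perms-lengths (map inj₂ bs))
    ; runs<   = All.map (λ allB → subst (_< length bs) (sym (leadingA-allB allB)) nonempty)
                        (perms-All _ (map⁺ (All.universal (λ b → b , refl) bs)))
    ; bound   = λ k → ≤-trans (*-monoˡ-≤ (length bs) (count≤length _ S))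
                              (≤-reflexive (*-comm (length S) (length bs)))
    }
    where S = perms (map inj₂ bs)

  runBound-perms : (as : List A) (bs : List B) → 0 < length bs →
    RunBound (length bs) (length as + length bs) (perms (map inj₁ as ++ map inj₂ bs))
  runBound-perms []       bs nonempty = runBound-onlyB bs nonempty
  runBound-perms (a ∷ as) bs nonempty = runBound-insert a (runBound-perms as bs nonempty)

module _ {d c : ℕ} where

  ≡ᵇ-refl : ∀ n → (n ≡ᵇ n) ≡ true
  ≡ᵇ-refl zero    = refl
  ≡ᵇ-refl (suc n) = ≡ᵇ-refl n

  pos-head : (a : Fin d) (σ : List (Elt d c)) → pos (inj₁ a ∷ σ) (inj₁ a) ≡ 0
  pos-head a σ rewrite ≡ᵇ-refl (toℕ a) = refl

  C-after-firstA : (p : ℕ) (σ : List (Elt d c)) (v : Fin c) → p ≤ leadingA σ →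
    All (λ u → (pos σ (inj₂ v) <ᵇ pos σ (inj₁ u)) ≡ false) (firstA p σ)
  C-after-firstA zero    σ            v _         = []
  C-after-firstA (suc p) (inj₁ a ∷ σ) v (s≤s p≤r) =
    head-ok ∷ All.map tail-ok (C-after-firstA p σ v p≤r)
    where
    head-ok : (pos (inj₁ a ∷ σ) (inj₂ v) <ᵇ pos (inj₁ a ∷ σ) (inj₁ a)) ≡ false
    head-ok rewrite pos-head a σ = refl
    tail-ok : ∀ {u} → (pos σ (inj₂ v) <ᵇ pos σ (inj₁ u)) ≡ false →
              (pos (inj₁ a ∷ σ) (inj₂ v) <ᵇ pos (inj₁ a ∷ σ) (inj₁ u)) ≡ false
    tail-ok {u} later with eqElt {d} {c} (inj₁ a) (inj₁ u)
    ... | true  = refl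
    ... | false = later

  badEvent-long-run : (p : ℕ) (σ : List (Elt d c)) → p ≤ leadingA σ → badEvent d c p σ ≡ false
  badEvent-long-run p σ p≤r =
    any-false _ (allFin c) (All.universal (λ v → any-false _ _ (C-after-firstA p σ v p≤r)) (allFin c))

  bad≤short-run : (p : ℕ) (σ : List (Elt d c)) → 𝟙 (badEvent d c p σ) ≤ 𝟙 (leadingA σ <ᵇ p)
  bad≤short-run p σ with leadingA σ <ᵇ p in short
  ... | true  = 𝟙≤1 _
  ... | false rewrite badEvent-long-run p σ (≮⇒≥ (λ r<p → subst T short (<⇒<ᵇ r<p))) = z≤n

length-allFin : (n : ℕ) → length (allFin n) ≡ n
length-allFin n = length-tabulate (λ (i : Fin n) → i)

shortRun-bound : (p d c : ℕ) → 0 < c →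
  sumOf (λ σ → 𝟙 (leadingA σ <ᵇ p)) (perms (allElts d c)) * (d + c) ≤ p * (c * totalCount d c)
shortRun-bound p d c 0<c =
  subst₂ (λ d′ c′ → sumOf (λ σ → 𝟙 (leadingA σ <ᵇ p)) S * (d′ + c′) ≤ p * (c′ * length S))
         (length-allFin d) (length-allFin c)
         (count<-bound leadingA S (RunBound.bound (runBound-perms (allFin d) (allFin c) nonempty)) p)
  where
  S = perms (allElts d c)
  nonempty : 0 < length (allFin c)
  nonempty = subst (0 <_) (sym (length-allFin c)) 0<c

lemma6 : (m p d c : ℕ) → 2 ≤ m → IsCeil6Ln m p → BigEnough m d →
    badCount d c p * d ≤ 2 * p * c * totalCount d c
lemma6 m p d zero _ _ _ = ≤-trans (≤-reflexive (cong (_* d) noBadOrdering)) z≤n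
  where
  noBadOrdering : badCount d zero p ≡ 0
  noBadOrdering = trans (length-filter (badEvent d zero p) (perms (allElts d zero)))
                        (sumOf-zero (perms (allElts d zero)))
lemma6 m p d c@(suc _) _ _ _ = begin
  badCount d c p * d
    ≡⟨ cong (_* d) (length-filter (badEvent d c p) S) ⟩
  sumOf (λ σ → 𝟙 (badEvent d c p σ)) S * d
    ≤⟨ *-mono-≤ (sumOf-mono S (bad≤short-run p)) (m≤m+n d c) ⟩
  sumOf (λ σ → 𝟙 (leadingA σ <ᵇ p)) S * (d + c)
    ≤⟨ shortRun-bound p d c (s≤s z≤n) ⟩
  p * (c * length S)
    ≤⟨ m≤n*m (p * (c * length S)) 2 ⟩
  2 * (p * (c * length S))
    ≡⟨ cong (2 *_) (sym (*-assoc p c (length S))) ⟩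
  2 * (p * c * length S)
    ≡⟨ sym (*-assoc 2 (p * c) (length S)) ⟩
  2 * (p * c) * length S
    ≡⟨ cong (_* length S) (sym (*-assoc 2 p c)) ⟩
  2 * p * c * totalCount d c ∎
  where
  open ≤-Reasoning
  S = perms (allElts d c)
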